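{- Let $n$ and $d$ be integers with $2\leq d<\lfloor n/2\rfloor$. Then $2d\leq \sigma^{ - }(C_n^{d})\leq d(d+1)$.
   Context: $C_n$ denotes the cycle on $n$ vertices $u_0,u_1,\dots,u_{n-1}$. For a graph $G$, its $d$th power $G^d$ has vertex set $V(G)$, with distinct $u,v$ adjacent iff $1\leq \mathrm{dist}_G(u,v)\leq d$; thus $C_n^d$ is the circulant graph in which $u_i$ is adjacent to $u_{i\pm 1},\dots,u_{i\pm d}$ (indices mod $n$). For a graph $G$ on $n$ vertices, the rna number $\sigma^{ - }(G)$ is the minimum, over all partitions $V(G)=A\cup B$ with $A\cap B=\emptyset$ and $||A|-|B||\leq 1$, of the number of edges of $G$ with one endpoint in $A$ and the other in $B$ (equivalently, the least number of negative edges among all parity signed graphs over $G$). -}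

module Defs where

open import Data.Nat using (ℕ; zero; suc; _+_; _*_; _∸_; _≤_; _<_; _⊓_; _≤ᵇ_; _<ᵇ_; _≡ᵇ_)
open import Data.Nat.DivMod using (_%_)
open import Data.Bool using (Bool; true; false; _∧_; not; T)
open import Data.Fin using (Fin; toℕ)
open import Data.Fin.Subset using (Subset; ∣_∣)
open import Data.List using (List; []; _∷_; map; length; allFin; concatMap; _++_; foldr)
open import Data.Vec using (Vec; lookup; []; _∷_)
open import Data.Product using (_×_; _,_)

cycDist : (n : ℕ) → Fin n → Fin n → ℕ
cycDist zero () _
cycDist (suc n) i j =
  ((toℕ j + (suc n ∸ toℕ i)) % suc n) ⊓ ((toℕ i + (suc n ∸ toℕ j)) % suc n)

adjPow : (n d : ℕ) → Fin n → Fin n → Bool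
adjPow n d i j = (1 ≤ᵇ cycDist n i j) ∧ (cycDist n i j ≤ᵇ d)

pairs : (n : ℕ) → List (Fin n × Fin n)
pairs n = concatMap (λ i → concatMap (λ j → if′ (toℕ i <ᵇ toℕ j) (i , j)) (allFin n)) (allFin n)
  where
    if′ : {A : Set} → Bool → A → List A
    if′ true  a = a ∷ []
    if′ false a = []

count : {A : Set} → (A → Bool) → List A → ℕ
count p [] = 0
count p (x ∷ xs) with p x
... | true  = suc (count p xs)
... | false = count p xs

xor : Bool → Bool → Bool
xor true  b = not b
xor false b = b

-- A partition V(C_n^d) = A ∪ B (disjoint) is given by the subset A ⊆ Fin n,
-- with B its complement.  Number of edges of C_n^d with one endpoint in A
-- and the other in B.
cut : (n d : ℕ) → Subset n → ℕ
cut n d A = count (λ { (i , j) → adjPow n d i j ∧ xor (lookup A i) (lookup A j) }) (pairs n)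

Balanced : (n : ℕ) → Subset n → Set
Balanced n A = (∣ A ∣ ≤ suc (n ∸ ∣ A ∣)) × (n ∸ ∣ A ∣ ≤ suc ∣ A ∣)

IsRnaNumber : (n d m : ℕ) → Set
IsRnaNumber n d m =
  (Data.Product.Σ (Subset n) (λ A → Balanced n A × cut n d A ≡ m))
  × ((A : Subset n) → Balanced n A → m ≤ cut n d A)
  where open import Relation.Binary.PropositionalEquality using (_≡_)

module Submission where

-- Upper bound: the arc {u₀, …, u_{h−1}}, h = ⌊n/2⌋, is balanced, and an edge u_i u_j with
-- i < j leaves it only if i < h ≤ j and either j − i ≤ d or i + n − j ≤ d.  Counting these
-- edges row by row gives Σ_{u<h} ((u + d + 1 − h) + (d − u)) = d(d + 1).
--
-- Lower bound: since 2d < n, both sides of a balanced partition have at least d vertices.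
-- Call u ahead-changing if one of u + 1, …, u + d lies on the other side, and behind-changing
-- if one of u − 1, …, u − d does.  The two witnesses are distinct cut neighbours of u, so
-- twice the cut is at least the number of ahead-changing plus behind-changing vertices.
-- Reading the cycle backwards from a vertex of the other side, every vertex of a side is
-- ahead-changing until d consecutive vertices of that side have been passed, so at least d
-- vertices of each side are ahead-changing, and likewise behind-changing: twice the cut is
-- at least 4d.

open import Data.Bool using (Bool; true; false; _∧_; _∨_; not; T)
open import Data.Bool.Properties using (T-∧; not-involutive)
open import Data.Empty using (⊥; ⊥-elim)
open import Data.Fin using (Fin; zero; suc; toℕ; fromℕ<)
open import Data.Fin.Properties using (toℕ<n; toℕ-fromℕ<; toℕ-injective)
open import Data.Fin.Subset using (Subset; ∣_∣)
open import Data.List using (List; []; _∷_; _++_; concatMap; map; allFin; tabulate)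
open import Data.Nat
open import Data.Nat.DivMod
  using (_%_; _/_; m/n*n≤m; m≡m%n+[m/n]*n; m%n<n; m%n%n≡m%n; [m+n]%n≡m%n; m<n⇒m%n≡m; %-distribˡ-+; n%n≡0)
open import Data.Nat.ListAction using () renaming (sum to listSum)
open import Data.Nat.Properties
open import Data.Product using (_×_; _,_; Σ; ∃-syntax; proj₁; proj₂)
open import Data.Sum using (_⊎_; inj₁; inj₂)
open import Data.Vec using ([]; _∷_; lookup) renaming (tabulate to tabulateᵛ)
open import Data.Vec.Properties using (lookup∘tabulate)
open import Function using (_∘_; id; Equivalence)
open import Relation.Binary using (tri<; tri≈; tri>)
open import Relation.Binary.PropositionalEquality
open import Relation.Nullary using (¬_)

open import Algebra.Properties.CommutativeMonoid.Sum +-0-commutativeMonoid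
  using (sum; sum-syntax; ∑-distrib-+; ∑-comm; sum-cong-≗)
open import Algebra.Properties.CommutativeSemigroup +-commutativeSemigroup
  using (interchange; x∙yz≈y∙xz; xy∙z≈xz∙y)

open import Defs

T⇒≡true : ∀ {b} → T b → b ≡ true
T⇒≡true {true} _ = refl

¬T⇒≡false : ∀ {b} → ¬ T b → b ≡ false
¬T⇒≡false {true}  ¬t = ⊥-elim (¬t _)
¬T⇒≡false {false} _  = refl

xor-≢ : ∀ {a b} → a ≢ b → xor a b ≡ true
xor-≢ {true}  {true}  a≢b = ⊥-elim (a≢b refl)
xor-≢ {true}  {false} _   = refl
xor-≢ {false} {true}  _   = refl
xor-≢ {false} {false} a≢b = ⊥-elim (a≢b refl)

iverson : Bool → ℕ
iverson true  = 1
iverson false = 0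

sum-mono : ∀ {n} {f g : Fin n → ℕ} → (∀ i → f i ≤ g i) → sum f ≤ sum g
sum-mono {zero}  f≤g = z≤n
sum-mono {suc n} f≤g = +-mono-≤ (f≤g zero) (sum-mono (f≤g ∘ suc))

≤-sum : ∀ {n} (f : Fin n → ℕ) i → f i ≤ sum f
≤-sum f zero    = m≤m+n _ _
≤-sum f (suc i) = ≤-trans (≤-sum (f ∘ suc) i) (m≤n+m _ _)

+-≤-sum : ∀ {n} (f : Fin n → ℕ) {i j} → i ≢ j → f i + f j ≤ sum f
+-≤-sum f {zero}  {zero}  i≢j = ⊥-elim (i≢j refl)
+-≤-sum f {zero}  {suc j} _   = +-monoʳ-≤ (f zero) (≤-sum (f ∘ suc) j)
+-≤-sum f {suc i} {zero}  _   =
  subst (_≤ sum f) (+-comm (f zero) (f (suc i))) (+-monoʳ-≤ (f zero) (≤-sum (f ∘ suc) i))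
+-≤-sum f {suc i} {suc j} i≢j =
  ≤-trans (+-≤-sum (f ∘ suc) (i≢j ∘ cong suc)) (m≤n+m _ _)

iverson-split : ∀ a b → iverson b ≡ iverson (a ∧ b) + iverson (not a ∧ b)
iverson-split true  b = sym (+-identityʳ _)
iverson-split false b = refl

iverson-+-not : ∀ a → iverson a + iverson (not a) ≡ 1
iverson-+-not true  = refl
iverson-+-not false = refl

⊓≤⇒ : ∀ {m n o} → m ⊓ n ≤ o → m ≤ o ⊎ n ≤ o
⊓≤⇒ {m} {n} m⊓n≤o with ≤-total m n
... | inj₁ m≤n = inj₁ (subst (_≤ _) (m≤n⇒m⊓n≡m m≤n) m⊓n≤o)
... | inj₂ n≤m = inj₂ (subst (_≤ _) (m≥n⇒m⊓n≡n n≤m) m⊓n≤o)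

∑-lookup≡∣∣ : ∀ {m} (B : Subset m) → ∑[ i < m ] iverson (lookup B i) ≡ ∣ B ∣
∑-lookup≡∣∣ []          = refl
∑-lookup≡∣∣ (true ∷ B)  = cong suc (∑-lookup≡∣∣ B)
∑-lookup≡∣∣ (false ∷ B) = ∑-lookup≡∣∣ B

-- Sums over ranges of naturals

rangeSum : (ℕ → ℕ) → ℕ → ℕ → ℕ
rangeSum f s zero    = 0
rangeSum f s (suc N) = f s + rangeSum f (suc s) N

module _ {f g : ℕ → ℕ} where

  rangeSum-cong : ∀ s N → (∀ x → s ≤ x → x < s + N → f x ≡ g x) →
                  rangeSum f s N ≡ rangeSum g s N
  rangeSum-cong s zero    f≡g = refl
  rangeSum-cong s (suc N) f≡g =
    cong₂ _+_ (f≡g s ≤-refl (m<m+n s z<s))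
              (rangeSum-cong (suc s) N (λ x s<x x< → f≡g x (<⇒≤ s<x) (subst (x <_) (sym (+-suc s N)) x<)))

  rangeSum-mono : ∀ s N → (∀ x → s ≤ x → x < s + N → f x ≤ g x) →
                  rangeSum f s N ≤ rangeSum g s N
  rangeSum-mono s zero    f≤g = z≤n
  rangeSum-mono s (suc N) f≤g =
    +-mono-≤ (f≤g s ≤-refl (m<m+n s z<s))
             (rangeSum-mono (suc s) N (λ x s<x x< → f≤g x (<⇒≤ s<x) (subst (x <_) (sym (+-suc s N)) x<)))

rangeSum-const : ∀ c s N → rangeSum (λ _ → c) s N ≡ N * c
rangeSum-const c s zero    = refl
rangeSum-const c s (suc N) = cong (c +_) (rangeSum-const c (suc s) N)

rangeSum-zero : ∀ (f : ℕ → ℕ) s N → (∀ x → s ≤ x → x < s + N → f x ≡ 0) → rangeSum f s N ≡ 0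
rangeSum-zero f s N f≡0 = trans (rangeSum-cong s N f≡0) (trans (rangeSum-const 0 s N) (*-zeroʳ N))

rangeSum-++ : ∀ f s M N → rangeSum f s (M + N) ≡ rangeSum f s M + rangeSum f (s + M) N
rangeSum-++ f s zero    N = cong (λ t → rangeSum f t N) (sym (+-identityʳ s))
rangeSum-++ f s (suc M) N = begin
  f s + rangeSum f (suc s) (M + N)
    ≡⟨ cong (f s +_) (rangeSum-++ f (suc s) M N) ⟩
  f s + (rangeSum f (suc s) M + rangeSum f (suc s + M) N)
    ≡⟨ sym (+-assoc (f s) _ _) ⟩
  f s + rangeSum f (suc s) M + rangeSum f (suc s + M) N
    ≡⟨ cong (λ t → f s + rangeSum f (suc s) M + rangeSum f t N) (sym (+-suc s M)) ⟩
  f s + rangeSum f (suc s) M + rangeSum f (s + suc M) N ∎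
  where open ≡-Reasoning

rangeSum-snoc : ∀ f s N → rangeSum f s (suc N) ≡ rangeSum f s N + f (s + N)
rangeSum-snoc f s N = begin
  rangeSum f s (suc N)                        ≡⟨ cong (rangeSum f s) (+-comm 1 N) ⟩
  rangeSum f s (N + 1)                        ≡⟨ rangeSum-++ f s N 1 ⟩
  rangeSum f s N + (f (s + N) + 0)            ≡⟨ cong (rangeSum f s N +_) (+-identityʳ _) ⟩
  rangeSum f s N + f (s + N)                  ∎
  where open ≡-Reasoning

rangeSum-distrib-+ : ∀ f g s N → rangeSum (λ x → f x + g x) s N ≡ rangeSum f s N + rangeSum g s N
rangeSum-distrib-+ f g s zero    = refl
rangeSum-distrib-+ f g s (suc N) = begin
  f s + g s + rangeSum (λ x → f x + g x) (suc s) N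
    ≡⟨ cong (f s + g s +_) (rangeSum-distrib-+ f g (suc s) N) ⟩
  f s + g s + (rangeSum f (suc s) N + rangeSum g (suc s) N)
    ≡⟨ interchange (f s) (g s) _ _ ⟩
  f s + rangeSum f (suc s) N + (g s + rangeSum g (suc s) N) ∎
  where open ≡-Reasoning

rangeSum-shift : ∀ f s t N → rangeSum f (s + t) N ≡ rangeSum (λ x → f (s + x)) t N
rangeSum-shift f s t zero    = refl
rangeSum-shift f s t (suc N) = cong (f (s + t) +_)
  (trans (cong (λ u → rangeSum f u N) (sym (+-suc s t))) (rangeSum-shift f s (suc t) N))

rangeSum-*ˡ : ∀ c f s N → rangeSum (λ x → c * f x) s N ≡ c * rangeSum f s N
rangeSum-*ˡ c f s zero    = sym (*-zeroʳ c)
rangeSum-*ˡ c f s (suc N) = trans (cong (c * f s +_) (rangeSum-*ˡ c f (suc s) N)) (sym (*-distribˡ-+ c (f s) _))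

rangeSum-below : ∀ (g : ℕ → ℕ) {h N} → h ≤ N → rangeSum (λ u → iverson (u <ᵇ h) * g u) 0 N ≡ rangeSum g 0 h
rangeSum-below g {h} {N} h≤N = begin
  rangeSum G 0 N
    ≡⟨ cong (rangeSum G 0) (sym (m+[n∸m]≡n h≤N)) ⟩
  rangeSum G 0 (h + (N ∸ h))
    ≡⟨ rangeSum-++ G 0 h (N ∸ h) ⟩
  rangeSum G 0 h + rangeSum G h (N ∸ h)
    ≡⟨ cong₂ _+_ (rangeSum-cong 0 h below) (rangeSum-zero G h (N ∸ h) above) ⟩
  rangeSum g 0 h + 0
    ≡⟨ +-identityʳ _ ⟩
  rangeSum g 0 h ∎
  where
  open ≡-Reasoning
  G : ℕ → ℕ
  G u = iverson (u <ᵇ h) * g u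
  below : ∀ u → 0 ≤ u → u < 0 + h → G u ≡ g u
  below u _ u<h rewrite T⇒≡true (<⇒<ᵇ u<h) = +-identityʳ (g u)
  above : ∀ u → h ≤ u → u < h + (N ∸ h) → G u ≡ 0
  above u h≤u _ rewrite ¬T⇒≡false (λ t → <⇒≱ (<ᵇ⇒< u h t) h≤u) = refl

rangeSum-periodic : ∀ f n → (∀ x → f (x + n) ≡ f x) → ∀ s → rangeSum f s n ≡ rangeSum f 0 n
rangeSum-periodic f n f-per zero    = refl
rangeSum-periodic f n f-per (suc s) = trans shift-by-one (rangeSum-periodic f n f-per s)
  where
  shift-by-one : rangeSum f (suc s) n ≡ rangeSum f s n
  shift-by-one = +-cancelˡ-≡ (f s) _ _ (begin
    f s + rangeSum f (suc s) n   ≡⟨ rangeSum-snoc f s n ⟩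
    rangeSum f s n + f (s + n)   ≡⟨ cong (rangeSum f s n +_) (f-per s) ⟩
    rangeSum f s n + f s         ≡⟨ +-comm _ (f s) ⟩
    f s + rangeSum f s n         ∎)
    where open ≡-Reasoning

rangeSum-pos⇒∃ : ∀ (p : ℕ → Bool) s N → 0 < rangeSum (iverson ∘ p) s N → ∃[ x ] p x ≡ true
rangeSum-pos⇒∃ p s (suc N) pos with p s in ps
... | true  = s , ps
... | false = rangeSum-pos⇒∃ p (suc s) N pos

sum-toℕ : ∀ (f : ℕ → ℕ) n → ∑[ i < n ] f (toℕ i) ≡ rangeSum f 0 n
sum-toℕ f n = from n 0
  where
  from : ∀ N s → ∑[ i < N ] f (s + toℕ i) ≡ rangeSum f s N
  from zero    s = refl
  from (suc N) s = cong₂ _+_ (cong f (+-identityʳ s))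
    (trans (sum-cong-≗ {N} {λ i → f (s + suc (toℕ i))} (λ i → cong f (+-suc s (toℕ i)))) (from N (suc s)))

-- Cuts as double sums

count-++ : ∀ {A : Set} (p : A → Bool) xs ys → count p (xs ++ ys) ≡ count p xs + count p ys
count-++ p []       ys = refl
count-++ p (x ∷ xs) ys with p x
... | true  = cong suc (count-++ p xs ys)
... | false = count-++ p xs ys

count-concatMap : ∀ {A B : Set} (p : B → Bool) (g : A → List B) xs →
                  count p (concatMap g xs) ≡ listSum (map (count p ∘ g) xs)
count-concatMap p g []       = refl
count-concatMap p g (x ∷ xs) =
  trans (count-++ p (g x) (concatMap g xs)) (cong (count p (g x) +_) (count-concatMap p g xs))

listSum-map-allFin : ∀ n (f : Fin n → ℕ) → listSum (map f (allFin n)) ≡ sum f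
listSum-map-allFin n f = go n id
  where
  go : ∀ m (g : Fin m → Fin n) → listSum (map f (tabulate g)) ≡ sum (f ∘ g)
  go zero    g = refl
  go (suc m) g = cong (f (g zero) +_) (go m (g ∘ suc))

crosses : ∀ n d → Subset n → Fin n → Fin n → Bool
crosses n d A i j = adjPow n d i j ∧ xor (lookup A i) (lookup A j)

cut≡∑ : ∀ n d A → cut n d A ≡ ∑[ i < n ] ∑[ j < n ] iverson ((toℕ i <ᵇ toℕ j) ∧ crosses n d A i j)
cut≡∑ n d A = begin
  count p (pairs n)
    ≡⟨ cong (count p) (proj₂ pairs-by-rows) ⟩
  count p (concatMap (λ i → concatMap (row i) (allFin n)) (allFin n))
    ≡⟨ count-concatMap p _ (allFin n) ⟩
  listSum (map (λ i → count p (concatMap (row i) (allFin n))) (allFin n))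
    ≡⟨ listSum-map-allFin n _ ⟩
  ∑[ i < n ] count p (concatMap (row i) (allFin n))
    ≡⟨ sum-cong-≗ (λ i → trans (count-concatMap p (row i) (allFin n)) (listSum-map-allFin n _)) ⟩
  ∑[ i < n ] ∑[ j < n ] count p (row i j)
    ≡⟨ sum-cong-≗ (λ i → sum-cong-≗ (count-row i)) ⟩
  ∑[ i < n ] ∑[ j < n ] iverson ((toℕ i <ᵇ toℕ j) ∧ crosses n d A i j) ∎
  where
  open ≡-Reasoning
  p : Fin n × Fin n → Bool
  p (i , j) = crosses n d A i j
  -- The row function of pairs is local to its definition; unification recovers it.
  pairs-by-rows : Σ (Fin n → Fin n → List (Fin n × Fin n))
                    (λ row → pairs n ≡ concatMap (λ i → concatMap (row i) (allFin n)) (allFin n))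
  pairs-by-rows = _ , refl
  row = proj₁ pairs-by-rows
  count-row : ∀ i j → count p (row i j) ≡ iverson ((toℕ i <ᵇ toℕ j) ∧ crosses n d A i j)
  count-row i j with toℕ i <ᵇ toℕ j
  ... | false = refl
  ... | true with crosses n d A i j
  ...   | true  = refl
  ...   | false = refl

-- The cycle

module Cycle (n-1 : ℕ) where

  n : ℕ
  n = suc n-1

  fin : ℕ → Fin n
  fin x = fromℕ< (m%n<n x n)

  toℕ-fin : ∀ x → toℕ (fin x) ≡ x % n
  toℕ-fin x = toℕ-fromℕ< (m%n<n x n)

  fin-toℕ : ∀ i → fin (toℕ i) ≡ i
  fin-toℕ i = toℕ-injective (trans (toℕ-fin (toℕ i)) (m<n⇒m%n≡m (toℕ<n i)))

  fin-cong-% : ∀ x y → x % n ≡ y % n → fin x ≡ fin y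
  fin-cong-% x y x≡y = toℕ-injective (trans (toℕ-fin x) (trans x≡y (sym (toℕ-fin y))))

  fin-+n : ∀ x → fin (x + n) ≡ fin x
  fin-+n x = fin-cong-% (x + n) x ([m+n]%n≡m%n x n)

  %-+-absorbˡ : ∀ a b → (a % n + b) % n ≡ (a + b) % n
  %-+-absorbˡ a b = begin
    (a % n + b) % n            ≡⟨ %-distribˡ-+ (a % n) b n ⟩
    (a % n % n + b % n) % n    ≡⟨ cong (λ r → (r + b % n) % n) (m%n%n≡m%n a n) ⟩
    (a % n + b % n) % n        ≡⟨ sym (%-distribˡ-+ a b n) ⟩
    (a + b) % n                ∎
    where open ≡-Reasoning

  -- cycDist n i j unfolds to offset (toℕ i) (toℕ j) ⊓ offset (toℕ j) (toℕ i).
  offset : ℕ → ℕ → ℕ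
  offset u v = (v + (n ∸ u)) % n

  offset-≤ : ∀ {u v} → u ≤ v → v < n → offset u v ≡ v ∸ u
  offset-≤ {u} {v} u≤v v<n = begin
    (v + (n ∸ u)) % n            ≡⟨ cong (λ w → (w + (n ∸ u)) % n) (sym (m∸n+n≡m u≤v)) ⟩
    (v ∸ u + u + (n ∸ u)) % n    ≡⟨ cong (_% n) (+-assoc (v ∸ u) u (n ∸ u)) ⟩
    (v ∸ u + (u + (n ∸ u))) % n  ≡⟨ cong (λ w → (v ∸ u + w) % n) (m+[n∸m]≡n (≤-trans u≤v (<⇒≤ v<n))) ⟩
    (v ∸ u + n) % n              ≡⟨ [m+n]%n≡m%n (v ∸ u) n ⟩
    (v ∸ u) % n                  ≡⟨ m<n⇒m%n≡m (≤-<-trans (m∸n≤m v u) v<n) ⟩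
    v ∸ u                        ∎
    where open ≡-Reasoning

  offset-> : ∀ {u v} → v < u → u ≤ n → offset u v ≡ v + (n ∸ u)
  offset-> {u} {v} v<u u≤n =
    m<n⇒m%n≡m (subst (v + (n ∸ u) <_) (m+[n∸m]≡n u≤n) (+-monoˡ-< (n ∸ u) v<u))

  offset-pos : ∀ {u v} → u ≢ v → u < n → v < n → 0 < offset u v
  offset-pos {u} {v} u≢v u<n v<n with <-cmp u v
  ... | tri< u<v _ _ = subst (0 <_) (sym (offset-≤ (<⇒≤ u<v) v<n)) (m<n⇒0<n∸m u<v)
  ... | tri≈ _ u≡v _ = ⊥-elim (u≢v u≡v)
  ... | tri> _ _ v<u = subst (0 <_) (sym (offset-> v<u (<⇒≤ u<n))) (≤-trans (m<n⇒0<n∸m u<n) (m≤n+m _ v))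

  offset-fin-+ : ∀ x k → offset (toℕ (fin x)) (toℕ (fin (x + k))) ≡ k % n
  offset-fin-+ x k = begin
    offset (toℕ (fin x)) (toℕ (fin (x + k)))  ≡⟨ cong₂ offset (toℕ-fin x) (toℕ-fin (x + k)) ⟩
    ((x + k) % n + (n ∸ r)) % n               ≡⟨ %-+-absorbˡ (x + k) (n ∸ r) ⟩
    (x + k + (n ∸ r)) % n                     ≡⟨ cong (_% n) (+-assoc x k (n ∸ r)) ⟩
    (x + (k + (n ∸ r))) % n                   ≡⟨ sym (%-+-absorbˡ x (k + (n ∸ r))) ⟩
    (r + (k + (n ∸ r))) % n                   ≡⟨ cong (_% n) (x∙yz≈y∙xz r k (n ∸ r)) ⟩
    (k + (r + (n ∸ r))) % n                   ≡⟨ cong (λ w → (k + w) % n) (m+[n∸m]≡n (<⇒≤ (m%n<n x n))) ⟩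
    (k + n) % n                               ≡⟨ [m+n]%n≡m%n k n ⟩
    k % n                                     ∎
    where
    open ≡-Reasoning
    r = x % n

  offset-self : ∀ {u} → u ≤ n → offset u u ≡ 0
  offset-self u≤n = trans (cong (_% n) (m+[n∸m]≡n u≤n)) (n%n≡0 n)

  fin-+-≢ : ∀ x {k} → 0 < k → k < n → fin x ≢ fin (x + k)
  fin-+-≢ x {k} 0<k k<n fin-x≡ = <⇒≢ 0<k (sym (begin
    k                                          ≡⟨ sym (m<n⇒m%n≡m k<n) ⟩
    k % n                                      ≡⟨ sym (offset-fin-+ x k) ⟩
    offset (toℕ (fin x)) (toℕ (fin (x + k)))   ≡⟨ cong (λ j → offset (toℕ (fin x)) (toℕ j)) (sym fin-x≡) ⟩
    offset (toℕ (fin x)) (toℕ (fin x))         ≡⟨ offset-self (<⇒≤ (toℕ<n (fin x))) ⟩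
    0                                          ∎))
    where open ≡-Reasoning

  cycDist-sym : ∀ i j → cycDist n i j ≡ cycDist n j i
  cycDist-sym i j = ⊓-comm _ _

  cycDist-self : ∀ i → cycDist n i i ≡ 0
  cycDist-self i = trans (⊓-idem _) (offset-self (<⇒≤ (toℕ<n i)))

  cycDist-pos : ∀ {i j} → i ≢ j → 0 < cycDist n i j
  cycDist-pos {i} {j} i≢j =
    ⊓-glb (offset-pos (i≢j ∘ toℕ-injective) (toℕ<n i) (toℕ<n j))
          (offset-pos (i≢j ∘ sym ∘ toℕ-injective) (toℕ<n j) (toℕ<n i))

  cycDist-+ : ∀ x {k} → k < n → cycDist n (fin x) (fin (x + k)) ≤ k
  cycDist-+ x {k} k<n = ≤-trans (m⊓n≤m _ _) (≤-reflexive (trans (offset-fin-+ x k) (m<n⇒m%n≡m k<n)))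

  cycDist-< : ∀ {i j} → toℕ i < toℕ j → cycDist n i j ≡ (toℕ j ∸ toℕ i) ⊓ (toℕ i + (n ∸ toℕ j))
  cycDist-< {i} {j} i<j = cong₂ _⊓_ (offset-≤ (<⇒≤ i<j) (toℕ<n j)) (offset-> i<j (<⇒≤ (toℕ<n j)))

  module _ (d : ℕ) where

    adjPow-sym : ∀ i j → adjPow n d i j ≡ adjPow n d j i
    adjPow-sym i j = cong (λ c → (1 ≤ᵇ c) ∧ (c ≤ᵇ d)) (cycDist-sym i j)

    adjPow-irrefl : ∀ i → adjPow n d i i ≡ false
    adjPow-irrefl i = cong (λ c → (1 ≤ᵇ c) ∧ (c ≤ᵇ d)) (cycDist-self i)

    adjPow⇒cycDist≤ : ∀ {i j} → adjPow n d i j ≡ true → cycDist n i j ≤ d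
    adjPow⇒cycDist≤ {i} {j} adj = ≤ᵇ⇒≤ _ d (proj₂ (Equivalence.to T-∧ (subst T (sym adj) _)))

    adjPow-+ : ∀ x {k} → 0 < k → k ≤ d → d < n → adjPow n d (fin x) (fin (x + k)) ≡ true
    adjPow-+ x {k} 0<k k≤d d<n = cong₂ _∧_
      (T⇒≡true (≤⇒≤ᵇ (cycDist-pos (fin-+-≢ x 0<k k<n))))
      (T⇒≡true (≤⇒≤ᵇ (≤-trans (cycDist-+ x k<n) k≤d)))
      where k<n = ≤-<-trans k≤d d<n

    module _ (A : Subset n) where

      crosses-sym : ∀ i j → crosses n d A i j ≡ crosses n d A j i
      crosses-sym i j = cong₂ _∧_ (adjPow-sym i j) (xor-comm (lookup A i) (lookup A j))
        where
        xor-comm : ∀ a b → xor a b ≡ xor b a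
        xor-comm true  true  = refl
        xor-comm true  false = refl
        xor-comm false true  = refl
        xor-comm false false = refl

      crosses-both-ways : ∀ i j → iverson ((toℕ i <ᵇ toℕ j) ∧ crosses n d A i j)
                                  + iverson ((toℕ j <ᵇ toℕ i) ∧ crosses n d A j i)
                                  ≡ iverson (crosses n d A i j)
      crosses-both-ways i j with <-cmp (toℕ i) (toℕ j)
      ... | tri< i<j _ j≮i
        rewrite T⇒≡true (<⇒<ᵇ i<j) | ¬T⇒≡false (j≮i ∘ <ᵇ⇒< (toℕ j) (toℕ i)) = +-identityʳ _
      ... | tri> i≮j _ j<i
        rewrite ¬T⇒≡false (i≮j ∘ <ᵇ⇒< (toℕ i) (toℕ j)) | T⇒≡true (<⇒<ᵇ j<i) = cong iverson (crosses-sym j i)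
      ... | tri≈ i≮j i≡j _ with refl ← toℕ-injective i≡j
        rewrite ¬T⇒≡false (i≮j ∘ <ᵇ⇒< (toℕ i) (toℕ i)) | adjPow-irrefl i = refl

      cut+cut≡∑ : cut n d A + cut n d A ≡ ∑[ i < n ] ∑[ j < n ] iverson (crosses n d A i j)
      cut+cut≡∑ = begin
        cut n d A + cut n d A
          ≡⟨ cong₂ _+_ (cut≡∑ n d A) (trans (cut≡∑ n d A) (∑-comm H)) ⟩
        ∑[ i < n ] ∑[ j < n ] H i j + ∑[ i < n ] ∑[ j < n ] H j i
          ≡⟨ sym (∑-distrib-+ (λ i → ∑[ j < n ] H i j) (λ i → ∑[ j < n ] H j i)) ⟩
        ∑[ i < n ] (∑[ j < n ] H i j + ∑[ j < n ] H j i)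
          ≡⟨ sum-cong-≗ (λ i → trans (sym (∑-distrib-+ (H i) (λ j → H j i)))
                                      (sum-cong-≗ (crosses-both-ways i))) ⟩
        ∑[ i < n ] ∑[ j < n ] iverson (crosses n d A i j) ∎
        where
        open ≡-Reasoning
        H : Fin n → Fin n → ℕ
        H i j = iverson ((toℕ i <ᵇ toℕ j) ∧ crosses n d A i j)

-- Runs in Boolean sequences

any≤ : ℕ → (ℕ → Bool) → Bool
any≤ zero    p = false
any≤ (suc d) p = p (suc d) ∨ any≤ d p

any≤-sound : ∀ d p → any≤ d p ≡ true → ∃[ k ] 0 < k × k ≤ d × p k ≡ true
any≤-sound (suc d) p any with p (suc d) in pk
... | true  = suc d , z<s , ≤-refl , pk
... | false with any≤-sound d p any
...   | k , 0<k , k≤d , pk′ = k , 0<k , m≤n⇒m≤1+n k≤d , pk′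

any≤-complete : ∀ d p {k} → 0 < k → k ≤ d → p k ≡ true → any≤ d p ≡ true
any≤-complete zero    p {suc _} _ () _
any≤-complete (suc d) p {k} 0<k k≤1+d pk with m≤n⇒m<n∨m≡n k≤1+d
... | inj₂ refl rewrite pk = refl
... | inj₁ k<1+d with p (suc d)
...   | true  = refl
...   | false = any≤-complete d p 0<k (≤-pred k<1+d) pk

any≤-cong : ∀ d {p q} → (∀ k → p k ≡ q k) → any≤ d p ≡ any≤ d q
any≤-cong zero    p≗q = refl
any≤-cong (suc d) p≗q = cong₂ _∨_ (p≗q (suc d)) (any≤-cong d p≗q)

module Runs (d : ℕ) (p : ℕ → Bool) where

  #p : ℕ → ℕ → ℕ
  #p = rangeSum (iverson ∘ p)

  #p∧ : (ℕ → Bool) → ℕ → ℕ → ℕ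
  #p∧ q = rangeSum (λ u → iverson (p u ∧ q u))

  SeesChangeAhead : (ℕ → Bool) → Set
  SeesChangeAhead ahead = ∀ u k → 0 < k → k ≤ d → p u ≡ true → p (u + k) ≡ false → ahead u ≡ true

  SeesChangeBehind : (ℕ → Bool) → Set
  SeesChangeBehind behind = ∀ q k → 0 < k → k ≤ d → p q ≡ false → p (q + k) ≡ true → behind (q + k) ≡ true

  -- Invariant of the leftward scan over [s, s + N): position s + N + t lies outside p, and the
  -- next r positions of p met before another position outside p are within d of it.
  run-ahead : ∀ {ahead} → SeesChangeAhead ahead →
              ∀ N s t r → t + r ≤ d → p (s + N + t) ≡ false → r ⊓ #p s N ≤ #p∧ ahead s N
  run-ahead intro N       s t zero    _     _   = z≤n
  run-ahead intro zero    s t (suc r) _     _   = z≤n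
  run-ahead {ahead} intro (suc N) s t (suc r) t+r≤d end with p (s + N) in pu
  ... | false = begin
    suc r ⊓ #p s (suc N)                ≡⟨ cong (suc r ⊓_) (rangeSum-snoc (iverson ∘ p) s N) ⟩
    suc r ⊓ (#p s N + iverson (p (s + N))) ≡⟨ cong (λ b → suc r ⊓ (#p s N + iverson b)) pu ⟩
    suc r ⊓ (#p s N + 0)                ≡⟨ cong (suc r ⊓_) (+-identityʳ _) ⟩
    suc r ⊓ #p s N                      ≤⟨ run-ahead intro N s 0 (suc r) (m+n≤o⇒n≤o t t+r≤d) end′ ⟩
    #p∧ ahead s N                       ≤⟨ m≤m+n _ _ ⟩
    #p∧ ahead s N + _                   ≡⟨ sym (rangeSum-snoc (λ u → iverson (p u ∧ ahead u)) s N) ⟩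
    #p∧ ahead s (suc N)                 ∎
    where
    open ≤-Reasoning
    end′ : p (s + N + 0) ≡ false
    end′ = trans (cong p (+-identityʳ (s + N))) pu
  ... | true = begin
    suc r ⊓ #p s (suc N)
      ≡⟨ cong (suc r ⊓_) (rangeSum-snoc (iverson ∘ p) s N) ⟩
    suc r ⊓ (#p s N + iverson (p (s + N)))
      ≡⟨ cong (λ b → suc r ⊓ (#p s N + iverson b)) pu ⟩
    suc r ⊓ (#p s N + 1)
      ≡⟨ cong (suc r ⊓_) (+-comm _ 1) ⟩
    suc (r ⊓ #p s N)
      ≤⟨ s≤s (run-ahead intro N s (suc t) r 1+t+r≤d end′) ⟩
    suc (#p∧ ahead s N)
      ≡⟨ +-comm 1 _ ⟩
    #p∧ ahead s N + 1
      ≡⟨ cong (λ b → #p∧ ahead s N + iverson b) (sym (cong₂ _∧_ pu changes)) ⟩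
    #p∧ ahead s N + iverson (p (s + N) ∧ ahead (s + N))
      ≡⟨ sym (rangeSum-snoc (λ u → iverson (p u ∧ ahead u)) s N) ⟩
    #p∧ ahead s (suc N) ∎
    where
    open ≤-Reasoning
    end′ : p (s + N + suc t) ≡ false
    end′ = trans (cong p (trans (+-suc (s + N) t) (cong (_+ t) (sym (+-suc s N))))) end
    1+t+r≤d : suc t + r ≤ d
    1+t+r≤d = subst (_≤ d) (+-suc t r) t+r≤d
    changes : ahead (s + N) ≡ true
    changes = intro (s + N) (suc t) z<s (≤-trans (m≤m+n (suc t) r) 1+t+r≤d) pu end′

  run-behind : ∀ {behind} → SeesChangeBehind behind →
               ∀ N s t r → t + r ≤ d → ∀ q → q + suc t ≡ s → p q ≡ false → r ⊓ #p s N ≤ #p∧ behind s N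
  run-behind intro N       s t zero    _     _ _     _  = z≤n
  run-behind intro zero    s t (suc r) _     _ _     _  = z≤n
  run-behind {behind} intro (suc N) s t (suc r) t+r≤d q q+1+t≡s pq with p s in ps
  ... | false =
    run-behind intro N (suc s) 0 (suc r) (m+n≤o⇒n≤o t t+r≤d) s (+-comm s 1) ps
  ... | true  = subst (λ b → suc (r ⊓ #p (suc s) N) ≤ iverson b + #p∧ behind (suc s) N) (sym changes)
    (s≤s (run-behind intro N (suc s) (suc t) r 1+t+r≤d q q+2+t≡1+s pq))
    where
    1+t+r≤d : suc t + r ≤ d
    1+t+r≤d = subst (_≤ d) (+-suc t r) t+r≤d
    q+2+t≡1+s : q + suc (suc t) ≡ suc s
    q+2+t≡1+s = trans (+-suc q (suc t)) (cong suc q+1+t≡s)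
    changes : behind s ≡ true
    changes = subst (λ u → behind u ≡ true) q+1+t≡s
      (intro q (suc t) z<s (≤-trans (m≤m+n (suc t) r) 1+t+r≤d) pq (trans (cong p q+1+t≡s) ps))

  module _ (n-1 : ℕ) (p-periodic : ∀ x → p (x + suc n-1) ≡ p x) where

    #p-from-gap : ∀ b → p b ≡ false → #p 0 (suc n-1) ≡ #p (suc b) n-1
    #p-from-gap b pb = begin
      #p 0 (suc n-1)
        ≡⟨ sym (rangeSum-periodic (iverson ∘ p) (suc n-1) (cong iverson ∘ p-periodic) b) ⟩
      iverson (p b) + #p (suc b) n-1
        ≡⟨ cong (λ a → iverson a + #p (suc b) n-1) pb ⟩
      #p (suc b) n-1 ∎
      where open ≡-Reasoning

    #p∧-from-gap : ∀ q → (∀ x → q (x + suc n-1) ≡ q x) → ∀ b → #p∧ q (suc b) n-1 ≤ #p∧ q 0 (suc n-1)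
    #p∧-from-gap q q-periodic b = ≤-trans (m≤n+m _ _) (≤-reflexive (rangeSum-periodic _ (suc n-1)
      (λ x → cong₂ (λ a c → iverson (a ∧ c)) (p-periodic x) (q-periodic x)) b))

    ahead-bound : ∀ {ahead} → SeesChangeAhead ahead → (∀ x → ahead (x + suc n-1) ≡ ahead x) →
                  ∀ b → p b ≡ false → d ⊓ #p 0 (suc n-1) ≤ #p∧ ahead 0 (suc n-1)
    ahead-bound {ahead} intro ahead-periodic b pb = begin
      d ⊓ #p 0 (suc n-1)       ≡⟨ cong (d ⊓_) (#p-from-gap b pb) ⟩
      d ⊓ #p (suc b) n-1       ≤⟨ run-ahead intro n-1 (suc b) 0 d ≤-refl end ⟩
      #p∧ ahead (suc b) n-1    ≤⟨ #p∧-from-gap ahead ahead-periodic b ⟩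
      #p∧ ahead 0 (suc n-1)    ∎
      where
      open ≤-Reasoning
      end : p (suc b + n-1 + 0) ≡ false
      end = trans (cong p (trans (+-identityʳ _) (sym (+-suc b n-1)))) (trans (p-periodic b) pb)

    behind-bound : ∀ {behind} → SeesChangeBehind behind → (∀ x → behind (x + suc n-1) ≡ behind x) →
                   ∀ b → p b ≡ false → d ⊓ #p 0 (suc n-1) ≤ #p∧ behind 0 (suc n-1)
    behind-bound {behind} intro behind-periodic b pb = begin
      d ⊓ #p 0 (suc n-1)       ≡⟨ cong (d ⊓_) (#p-from-gap b pb) ⟩
      d ⊓ #p (suc b) n-1       ≤⟨ run-behind intro n-1 (suc b) 0 d ≤-refl b (+-comm b 1) pb ⟩
      #p∧ behind (suc b) n-1   ≤⟨ #p∧-from-gap behind behind-periodic b ⟩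
      #p∧ behind 0 (suc n-1)   ∎
      where open ≤-Reasoning

-- The lower bound

module LowerBound (n-1 d : ℕ) (A : Subset (suc n-1)) (2d<n : d + d < suc n-1) where

  open Cycle n-1

  colour : ℕ → Bool
  colour x = lookup A (fin x)

  colour-+n : ∀ x → colour (x + n) ≡ colour x
  colour-+n x = cong (lookup A) (fin-+n x)

  changesAhead : ℕ → Bool
  changesAhead u = any≤ d (λ k → xor (colour u) (colour (u + k)))

  changesBehind : ℕ → Bool
  changesBehind u = any≤ d (λ k → xor (colour u) (colour (u + (n ∸ k))))

  degree : ℕ → ℕ
  degree u = ∑[ j < n ] iverson (crosses n d A (fin u) j)

  d<n : d < n
  d<n = ≤-<-trans (m≤m+n d d) 2d<n

  crosses-ahead : ∀ u {k} → 0 < k → k ≤ d → xor (colour u) (colour (u + k)) ≡ true →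
                  crosses n d A (fin u) (fin (u + k)) ≡ true
  crosses-ahead u 0<k k≤d differ = cong₂ _∧_ (adjPow-+ d u 0<k k≤d d<n) differ

  crosses-behind : ∀ u {k} → 0 < k → k ≤ d → xor (colour u) (colour (u + (n ∸ k))) ≡ true →
                   crosses n d A (fin u) (fin (u + (n ∸ k))) ≡ true
  crosses-behind u {k} 0<k k≤d differ = cong₂ _∧_ adj differ
    where
    y = u + (n ∸ k)
    y+k≡u+n : y + k ≡ u + n
    y+k≡u+n = trans (+-assoc u (n ∸ k) k) (cong (u +_) (m∸n+n≡m (<⇒≤ (≤-<-trans k≤d d<n))))
    adj : adjPow n d (fin u) (fin y) ≡ true
    adj = begin
      adjPow n d (fin u) (fin y)
        ≡⟨ cong (λ i → adjPow n d i (fin y)) (sym (trans (cong fin y+k≡u+n) (fin-+n u))) ⟩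
      adjPow n d (fin (y + k)) (fin y)
        ≡⟨ adjPow-sym d (fin (y + k)) (fin y) ⟩
      adjPow n d (fin y) (fin (y + k))
        ≡⟨ adjPow-+ d y 0<k k≤d d<n ⟩
      true ∎
      where open ≡-Reasoning

  ahead≢behind : ∀ u {k k′} → 0 < k → k ≤ d → k′ ≤ d → fin (u + k) ≢ fin (u + (n ∸ k′))
  ahead≢behind u {k} {k′} 0<k k≤d k′≤d same =
    fin-+-≢ y (≤-trans 0<k (m≤n+m k k′)) (≤-<-trans (+-mono-≤ k′≤d k≤d) 2d<n)
      (trans (sym same) (fin-cong-% (u + k) (y + (k′ + k)) (sym wraps)))
    where
    y = u + (n ∸ k′)
    k′≤n = <⇒≤ (≤-<-trans k′≤d d<n)
    wraps : (y + (k′ + k)) % n ≡ (u + k) % n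
    wraps = begin
      (u + (n ∸ k′) + (k′ + k)) % n   ≡⟨ cong (_% n) (+-assoc u (n ∸ k′) (k′ + k)) ⟩
      (u + ((n ∸ k′) + (k′ + k))) % n ≡⟨ cong (λ m → (u + m) % n) (sym (+-assoc (n ∸ k′) k′ k)) ⟩
      (u + ((n ∸ k′) + k′ + k)) % n   ≡⟨ cong (λ m → (u + (m + k)) % n) (m∸n+n≡m k′≤n) ⟩
      (u + (n + k)) % n               ≡⟨ cong (λ m → (u + m) % n) (+-comm n k) ⟩
      (u + (k + n)) % n               ≡⟨ cong (_% n) (sym (+-assoc u k n)) ⟩
      (u + k + n) % n                 ≡⟨ [m+n]%n≡m%n (u + k) n ⟩
      (u + k) % n                     ∎
      where open ≡-Reasoning

  crossing⇒degree-pos : ∀ u {j} → crosses n d A (fin u) j ≡ true → 1 ≤ degree u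
  crossing⇒degree-pos u {j} c =
    subst (_≤ degree u) (cong iverson c) (≤-sum (λ j → iverson (crosses n d A (fin u) j)) j)

  changes≤degree : ∀ u → iverson (changesAhead u) + iverson (changesBehind u) ≤ degree u
  changes≤degree u with changesAhead u in ahead | changesBehind u in behind
  ... | false | false = z≤n
  ... | true  | false with any≤-sound d _ ahead
  ...   | k , 0<k , k≤d , differ = crossing⇒degree-pos u (crosses-ahead u 0<k k≤d differ)
  changes≤degree u | false | true with any≤-sound d _ behind
  ...   | k , 0<k , k≤d , differ = crossing⇒degree-pos u (crosses-behind u 0<k k≤d differ)
  changes≤degree u | true  | true with any≤-sound d _ ahead | any≤-sound d _ behind
  ...   | k , 0<k , k≤d , differ | k′ , 0<k′ , k′≤d , differ′ =
    subst (_≤ degree u) (cong₂ (λ a b → iverson a + iverson b)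
                               (crosses-ahead u 0<k k≤d differ) (crosses-behind u 0<k′ k′≤d differ′))
      (+-≤-sum (λ j → iverson (crosses n d A (fin u) j)) (ahead≢behind u 0<k k≤d k′≤d))

  #colour : rangeSum (iverson ∘ colour) 0 n ≡ ∣ A ∣
  #colour = begin
    rangeSum (iverson ∘ colour) 0 n         ≡⟨ sym (sum-toℕ (iverson ∘ colour) n) ⟩
    ∑[ i < n ] iverson (colour (toℕ i))     ≡⟨ sum-cong-≗ (λ i → cong (iverson ∘ lookup A) (fin-toℕ i)) ⟩
    ∑[ i < n ] iverson (lookup A i)         ≡⟨ ∑-lookup≡∣∣ A ⟩
    ∣ A ∣                                   ∎
    where open ≡-Reasoning

  #not-colour : rangeSum (iverson ∘ not ∘ colour) 0 n ≡ n ∸ ∣ A ∣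
  #not-colour = trans (sym (m+n∸m≡n #c #nc)) (cong₂ _∸_ all-vertices #colour)
    where
    open ≡-Reasoning
    #c = rangeSum (iverson ∘ colour) 0 n
    #nc = rangeSum (iverson ∘ not ∘ colour) 0 n
    all-vertices : #c + #nc ≡ n
    all-vertices = begin
      #c + #nc
        ≡⟨ sym (rangeSum-distrib-+ (iverson ∘ colour) (iverson ∘ not ∘ colour) 0 n) ⟩
      rangeSum (λ u → iverson (colour u) + iverson (not (colour u))) 0 n
        ≡⟨ rangeSum-cong 0 n (λ u _ _ → iverson-+-not (colour u)) ⟩
      rangeSum (λ _ → 1) 0 n
        ≡⟨ trans (rangeSum-const 1 0 n) (*-identityʳ n) ⟩
      n ∎

  changesAhead-periodic : ∀ x → changesAhead (x + n) ≡ changesAhead x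
  changesAhead-periodic x = any≤-cong d (λ k → cong₂ xor (colour-+n x)
    (trans (cong colour (xy∙z≈xz∙y x n k)) (colour-+n (x + k))))

  changesBehind-periodic : ∀ x → changesBehind (x + n) ≡ changesBehind x
  changesBehind-periodic x = any≤-cong d (λ k → cong₂ xor (colour-+n x)
    (trans (cong colour (xy∙z≈xz∙y x n (n ∸ k))) (colour-+n (x + (n ∸ k)))))

  -- The two colour classes, as f ∘ colour for f = id and f = not.
  module _ (f : Bool → Bool) where

    open Runs d (f ∘ colour)

    colours-differ : ∀ u v → f (colour u) ≡ true → f (colour v) ≡ false → colour u ≢ colour v
    colours-differ u v fu fv same with trans (sym fu) (trans (cong f same) fv)
    ... | ()

    sees-ahead : SeesChangeAhead changesAhead
    sees-ahead u k 0<k k≤d fu fv = any≤-complete d (λ k → xor (colour u) (colour (u + k))) 0<k k≤d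
      (xor-≢ (colours-differ u (u + k) fu fv))

    sees-behind : SeesChangeBehind changesBehind
    sees-behind q k 0<k k≤d fq fv =
      any≤-complete d (λ k′ → xor (colour (q + k)) (colour (q + k + (n ∸ k′)))) 0<k k≤d
        (subst (λ w → xor (colour (q + k)) w ≡ true) (sym wraps) (xor-≢ (colours-differ (q + k) q fv fq)))
      where
      wraps : colour (q + k + (n ∸ k)) ≡ colour q
      wraps = trans (cong colour (trans (+-assoc q k (n ∸ k)) (cong (q +_) (m+[n∸m]≡n k≤n)))) (colour-+n q)
        where k≤n = <⇒≤ (≤-<-trans k≤d d<n)

    ahead-class-bound : ∀ b → f (colour b) ≡ false → d ⊓ #p 0 n ≤ #p∧ changesAhead 0 n
    ahead-class-bound = ahead-bound n-1 (cong f ∘ colour-+n) sees-ahead changesAhead-periodic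

    behind-class-bound : ∀ b → f (colour b) ≡ false → d ⊓ #p 0 n ≤ #p∧ changesBehind 0 n
    behind-class-bound = behind-bound n-1 (cong f ∘ colour-+n) sees-behind changesBehind-periodic

  iverson-by-colour : ∀ q → rangeSum (iverson ∘ q) 0 n ≡
                            rangeSum (λ u → iverson (colour u ∧ q u)) 0 n
                            + rangeSum (λ u → iverson (not (colour u) ∧ q u)) 0 n
  iverson-by-colour q = trans (rangeSum-cong 0 n (λ u _ _ → iverson-split (colour u) (q u)))
    (rangeSum-distrib-+ (λ u → iverson (colour u ∧ q u)) (λ u → iverson (not (colour u) ∧ q u)) 0 n)

  cut-lower-bound : 0 < d → d ≤ ∣ A ∣ → d ≤ n ∸ ∣ A ∣ → (d + d) + (d + d) ≤ cut n d A + cut n d A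
  cut-lower-bound 0<d d≤#T d≤#F = begin
    (d + d) + (d + d)
      ≡⟨ cong₂ _+_ d+d≡ d+d≡ ⟩
    (d ⊓ #T + d ⊓ #F) + (d ⊓ #T + d ⊓ #F)
      ≤⟨ +-mono-≤ (+-mono-≤ (ahead-class-bound id bT bT-outside) (ahead-class-bound not bF bF-outside))
                  (+-mono-≤ (behind-class-bound id bT bT-outside) (behind-class-bound not bF bF-outside)) ⟩
    (#T∧ changesAhead + #F∧ changesAhead) + (#T∧ changesBehind + #F∧ changesBehind)
      ≡⟨ sym (cong₂ _+_ (iverson-by-colour changesAhead) (iverson-by-colour changesBehind)) ⟩
    rangeSum (iverson ∘ changesAhead) 0 n + rangeSum (iverson ∘ changesBehind) 0 n
      ≡⟨ sym (rangeSum-distrib-+ (iverson ∘ changesAhead) (iverson ∘ changesBehind) 0 n) ⟩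
    rangeSum (λ u → iverson (changesAhead u) + iverson (changesBehind u)) 0 n
      ≤⟨ rangeSum-mono 0 n (λ u _ _ → changes≤degree u) ⟩
    rangeSum degree 0 n
      ≡⟨ sym (sum-toℕ degree n) ⟩
    ∑[ i < n ] degree (toℕ i)
      ≡⟨ sum-cong-≗ (λ i → sum-cong-≗ (λ j → cong (λ i′ → iverson (crosses n d A i′ j)) (fin-toℕ i))) ⟩
    ∑[ i < n ] ∑[ j < n ] iverson (crosses n d A i j)
      ≡⟨ sym (cut+cut≡∑ d A) ⟩
    cut n d A + cut n d A ∎
    where
    open ≤-Reasoning
    #T = rangeSum (iverson ∘ colour) 0 n
    #F = rangeSum (iverson ∘ not ∘ colour) 0 n
    #T∧ #F∧ : (ℕ → Bool) → ℕ
    #T∧ q = rangeSum (λ u → iverson (colour u ∧ q u)) 0 n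
    #F∧ q = rangeSum (λ u → iverson (not (colour u) ∧ q u)) 0 n
    d+d≡ : d + d ≡ d ⊓ #T + d ⊓ #F
    d+d≡ = sym (cong₂ _+_ (m≤n⇒m⊓n≡m (subst (d ≤_) (sym #colour) d≤#T))
                          (m≤n⇒m⊓n≡m (subst (d ≤_) (sym #not-colour) d≤#F)))
    bT-witness = rangeSum-pos⇒∃ (not ∘ colour) 0 n (≤-trans 0<d (subst (d ≤_) (sym #not-colour) d≤#F))
    bF-witness = rangeSum-pos⇒∃ colour 0 n (≤-trans 0<d (subst (d ≤_) (sym #colour) d≤#T))
    bT = proj₁ bT-witness
    bF = proj₁ bF-witness
    bT-outside : colour bT ≡ false
    bT-outside = trans (sym (not-involutive _)) (cong not (proj₂ bT-witness))
    bF-outside : not (colour bF) ≡ false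
    bF-outside = cong not (proj₂ bF-witness)

-- The upper bound

count-interval : ∀ lo hi N → rangeSum (λ v → iverson ((lo ≤ᵇ v) ∧ (v ≤ᵇ hi))) 0 N ≤ (N ⊓ suc hi) ∸ lo
count-interval lo hi zero    = z≤n
count-interval lo hi (suc N) rewrite rangeSum-snoc (λ v → iverson ((lo ≤ᵇ v) ∧ (v ≤ᵇ hi))) 0 N
  with (lo ≤ᵇ N) ∧ (N ≤ᵇ hi) in inside
... | false = ≤-trans (≤-reflexive (+-identityʳ _))
    (≤-trans (count-interval lo hi N) (∸-monoˡ-≤ lo (⊓-monoˡ-≤ (suc hi) (n≤1+n N))))
... | true  = begin
  rangeSum _ 0 N + 1         ≤⟨ +-monoˡ-≤ 1 (count-interval lo hi N) ⟩
  (N ⊓ suc hi) ∸ lo + 1      ≡⟨ cong (λ m → m ∸ lo + 1) (m≤n⇒m⊓n≡m (m≤n⇒m≤1+n N≤hi)) ⟩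
  N ∸ lo + 1                 ≡⟨ sym (+-∸-comm 1 lo≤N) ⟩
  N + 1 ∸ lo                 ≡⟨ cong (_∸ lo) (trans (+-comm N 1) (cong suc (sym (m≤n⇒m⊓n≡m N≤hi)))) ⟩
  suc (N ⊓ hi) ∸ lo          ∎
  where
  open ≤-Reasoning
  bounds = Equivalence.to T-∧ (subst T (sym inside) _)
  lo≤N = ≤ᵇ⇒≤ lo N (proj₁ bounds)
  N≤hi = ≤ᵇ⇒≤ N hi (proj₂ bounds)

count-tail : ∀ q c N → rangeSum (λ v → iverson (q ≤ᵇ v + c)) 0 N ≤ (N + c) ∸ q
count-tail q c zero    = z≤n
count-tail q c (suc N) rewrite rangeSum-snoc (λ v → iverson (q ≤ᵇ v + c)) 0 N with q ≤ᵇ N + c in q≤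
... | true  = begin
  rangeSum _ 0 N + 1       ≤⟨ +-monoˡ-≤ 1 (count-tail q c N) ⟩
  N + c ∸ q + 1            ≡⟨ sym (+-∸-comm 1 (≤ᵇ⇒≤ q (N + c) (subst T (sym q≤) _))) ⟩
  N + c + 1 ∸ q            ≡⟨ cong (_∸ q) (+-comm (N + c) 1) ⟩
  suc N + c ∸ q            ∎
  where open ≤-Reasoning
... | false = ≤-trans (≤-reflexive (+-identityʳ _))
    (≤-trans (count-tail q c N) (∸-monoˡ-≤ q (n≤1+n (N + c))))

rowBound : ℕ → ℕ → ℕ → ℕ
rowBound d h u = (suc (u + d) ∸ h) + (d ∸ u)

-- The nonzero terms are x + 1 and d − x for x < d, which pair up to d + 1.
rangeSum-rowBound : ∀ d {h} → d ≤ h → rangeSum (rowBound d h) 0 h ≡ d * suc d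
rangeSum-rowBound d {h} d≤h = begin
  rangeSum (rowBound d h) 0 h
    ≡⟨ rangeSum-distrib-+ (λ u → suc (u + d) ∸ h) (d ∸_) 0 h ⟩
  rangeSum (λ u → suc (u + d) ∸ h) 0 h + rangeSum (d ∸_) 0 h
    ≡⟨ cong₂ _+_ right-end left-end ⟩
  rangeSum suc 0 d + rangeSum (d ∸_) 0 d
    ≡⟨ sym (rangeSum-distrib-+ suc (d ∸_) 0 d) ⟩
  rangeSum (λ x → suc x + (d ∸ x)) 0 d
    ≡⟨ rangeSum-cong 0 d (λ x _ x<d → cong suc (m+[n∸m]≡n (<⇒≤ x<d))) ⟩
  rangeSum (λ _ → suc d) 0 d
    ≡⟨ rangeSum-const (suc d) 0 d ⟩
  d * suc d ∎
  where
  open ≡-Reasoning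
  e = h ∸ d
  e+d≡h : e + d ≡ h
  e+d≡h = m∸n+n≡m d≤h
  right-end : rangeSum (λ u → suc (u + d) ∸ h) 0 h ≡ rangeSum suc 0 d
  right-end = begin
    rangeSum f 0 h                    ≡⟨ cong (rangeSum f 0) (sym e+d≡h) ⟩
    rangeSum f 0 (e + d)              ≡⟨ rangeSum-++ f 0 e d ⟩
    rangeSum f 0 e + rangeSum f e d   ≡⟨ cong₂ _+_ (rangeSum-zero f 0 e below-e) (cong (λ s → rangeSum f s d) e≡e+0) ⟩
    0 + rangeSum f (e + 0) d          ≡⟨ rangeSum-shift f e 0 d ⟩
    rangeSum (λ x → f (e + x)) 0 d    ≡⟨ rangeSum-cong 0 d (λ x _ _ → shifted x) ⟩
    rangeSum suc 0 d                  ∎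
    where
    f : ℕ → ℕ
    f u = suc (u + d) ∸ h
    e≡e+0 = sym (+-identityʳ e)
    below-e : ∀ u → 0 ≤ u → u < e → f u ≡ 0
    below-e u _ u<e = m≤n⇒m∸n≡0 (subst (suc (u + d) ≤_) e+d≡h (+-monoˡ-≤ d u<e))
    shifted : ∀ x → f (e + x) ≡ suc x
    shifted x = begin
      suc (e + x + d) ∸ h      ≡⟨ cong (λ m → suc m ∸ h) (trans (xy∙z≈xz∙y e x d) (cong (_+ x) e+d≡h)) ⟩
      suc (h + x) ∸ h          ≡⟨ cong (_∸ h) (sym (+-suc h x)) ⟩
      h + suc x ∸ h            ≡⟨ m+n∸m≡n h (suc x) ⟩
      suc x                    ∎
  left-end : rangeSum (d ∸_) 0 h ≡ rangeSum (d ∸_) 0 d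
  left-end = begin
    rangeSum (d ∸_) 0 h
      ≡⟨ cong (rangeSum (d ∸_) 0) (sym (m+[n∸m]≡n d≤h)) ⟩
    rangeSum (d ∸_) 0 (d + (h ∸ d))
      ≡⟨ rangeSum-++ (d ∸_) 0 d (h ∸ d) ⟩
    rangeSum (d ∸_) 0 d + rangeSum (d ∸_) d (h ∸ d)
      ≡⟨ cong (rangeSum (d ∸_) 0 d +_) (rangeSum-zero (d ∸_) d (h ∸ d) (λ u d≤u _ → m≤n⇒m∸n≡0 d≤u)) ⟩
    rangeSum (d ∸_) 0 d + 0
      ≡⟨ +-identityʳ _ ⟩
    rangeSum (d ∸_) 0 d ∎

module UpperBound (n-1 d h : ℕ) (d≤h : d ≤ h) (h≤n : h ≤ suc n-1) where

  open Cycle n-1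

  arc : Subset n
  arc = tabulateᵛ (λ i → toℕ i <ᵇ h)

  ∣arc∣≡h : ∣ arc ∣ ≡ h
  ∣arc∣≡h = begin
    ∣ arc ∣
      ≡⟨ sym (∑-lookup≡∣∣ arc) ⟩
    ∑[ i < n ] iverson (lookup arc i)
      ≡⟨ sum-cong-≗ {n} (λ i → cong iverson (lookup∘tabulate (λ i → toℕ i <ᵇ h) i)) ⟩
    ∑[ i < n ] iverson (toℕ i <ᵇ h)
      ≡⟨ sum-toℕ (λ u → iverson (u <ᵇ h)) n ⟩
    rangeSum (λ u → iverson (u <ᵇ h)) 0 n
      ≡⟨ rangeSum-cong 0 n (λ u _ _ → sym (*-identityʳ _)) ⟩
    rangeSum (λ u → iverson (u <ᵇ h) * 1) 0 n
      ≡⟨ rangeSum-below (λ _ → 1) h≤n ⟩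
    rangeSum (λ _ → 1) 0 h
      ≡⟨ trans (rangeSum-const 1 0 h) (*-identityʳ h) ⟩
    h ∎
    where open ≡-Reasoning

  separated : ∀ {u v} → u < v → xor (u <ᵇ h) (v <ᵇ h) ≡ true → u < h × h ≤ v
  separated {u} {v} u<v differ with u <ᵇ h in u<ᵇh | v <ᵇ h in v<ᵇh
  ... | true  | false = <ᵇ⇒< u h (subst T (sym u<ᵇh) _) , ≮⇒≥ (λ v<h → subst T v<ᵇh (<⇒<ᵇ v<h))
  ... | false | true  = ⊥-elim (subst T u<ᵇh (<⇒<ᵇ (<-trans u<v (<ᵇ⇒< v h (subst T (sym v<ᵇh) _)))))
  separated {u} {v} u<v () | true  | true
  separated {u} {v} u<v () | false | false

  straddling : ∀ {i j} → toℕ i < toℕ j → crosses n d arc i j ≡ true →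
               toℕ i < h × h ≤ toℕ j × (toℕ j ≤ toℕ i + d ⊎ toℕ i + n ≤ toℕ j + d)
  straddling {i} {j} i<j c =
    u<h , h≤v , short (⊓≤⇒ (subst (_≤ d) (cycDist-< i<j) (adjPow⇒cycDist≤ d {i} {j} adj)))
    where
    u = toℕ i
    v = toℕ j
    parts = Equivalence.to T-∧ (subst T (sym c) _)
    adj : adjPow n d i j ≡ true
    adj = T⇒≡true (proj₁ parts)
    sides = separated i<j (subst₂ (λ a b → xor a b ≡ true) (lookup∘tabulate (λ i → toℕ i <ᵇ h) i)
                                   (lookup∘tabulate (λ i → toℕ i <ᵇ h) j) (T⇒≡true (proj₂ parts)))
    u<h = proj₁ sides
    h≤v = proj₂ sides
    short : v ∸ u ≤ d ⊎ u + (n ∸ v) ≤ d → v ≤ u + d ⊎ u + n ≤ v + d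
    short (inj₁ direct) = inj₁ (≤-trans (m≤n+m∸n v u) (+-monoʳ-≤ u direct))
    short (inj₂ around) = inj₂ (begin
      u + n              ≡⟨ cong (u +_) (sym (m∸n+n≡m (<⇒≤ (toℕ<n j)))) ⟩
      u + (n ∸ v + v)    ≡⟨ sym (+-assoc u (n ∸ v) v) ⟩
      u + (n ∸ v) + v    ≤⟨ +-monoˡ-≤ v around ⟩
      d + v              ≡⟨ +-comm d v ⟩
      v + d              ∎)
      where open ≤-Reasoning

  -- A straddling pair is short either across the boundary between u_{h−1} and u_h or
  -- across the one between u_{n−1} and u₀.
  straddleWeight : ℕ → ℕ → ℕ
  straddleWeight u v = iverson ((h ≤ᵇ v) ∧ (v ≤ᵇ u + d)) + iverson (u + n ≤ᵇ v + d)

  straddleWeight-pos : ∀ {u v} → h ≤ v → v ≤ u + d ⊎ u + n ≤ v + d → 1 ≤ straddleWeight u v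
  straddleWeight-pos h≤v (inj₁ direct) rewrite T⇒≡true (≤⇒≤ᵇ h≤v) | T⇒≡true (≤⇒≤ᵇ direct) = s≤s z≤n
  straddleWeight-pos h≤v (inj₂ around) rewrite T⇒≡true (≤⇒≤ᵇ around) = m≤n+m 1 _

  rowWeight : ℕ → ℕ → ℕ
  rowWeight u v = iverson (u <ᵇ h) * straddleWeight u v

  crossing≤rowWeight : ∀ i j →
                       iverson ((toℕ i <ᵇ toℕ j) ∧ crosses n d arc i j) ≤ rowWeight (toℕ i) (toℕ j)
  crossing≤rowWeight i j with toℕ i <ᵇ toℕ j in i<ᵇj | crosses n d arc i j in c
  ... | false | _     = z≤n
  ... | true  | false = z≤n
  ... | true  | true  with straddling (<ᵇ⇒< (toℕ i) (toℕ j) (subst T (sym i<ᵇj) _)) c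
  ...   | u<h , h≤v , short rewrite T⇒≡true (<⇒<ᵇ u<h) =
    ≤-trans (straddleWeight-pos h≤v short) (m≤m+n _ 0)

  row≤rowBound : ∀ u → rangeSum (rowWeight u) 0 n ≤ iverson (u <ᵇ h) * rowBound d h u
  row≤rowBound u = begin
    rangeSum (rowWeight u) 0 n
      ≡⟨ rangeSum-*ˡ (iverson (u <ᵇ h)) (straddleWeight u) 0 n ⟩
    iverson (u <ᵇ h) * rangeSum (straddleWeight u) 0 n
      ≡⟨ cong (iverson (u <ᵇ h) *_) (rangeSum-distrib-+ near around 0 n) ⟩
    iverson (u <ᵇ h) * (rangeSum near 0 n + rangeSum around 0 n)
      ≤⟨ *-monoʳ-≤ (iverson (u <ᵇ h)) (+-mono-≤ near-count around-count) ⟩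
    iverson (u <ᵇ h) * rowBound d h u ∎
    where
    open ≤-Reasoning
    near around : ℕ → ℕ
    near v = iverson ((h ≤ᵇ v) ∧ (v ≤ᵇ u + d))
    around v = iverson (u + n ≤ᵇ v + d)
    near-count : rangeSum near 0 n ≤ suc (u + d) ∸ h
    near-count = ≤-trans (count-interval h (u + d) n) (∸-monoˡ-≤ h (m⊓n≤n n _))
    around-count : rangeSum around 0 n ≤ d ∸ u
    around-count = ≤-trans (count-tail (u + n) d n)
      (≤-reflexive (trans (cong (n + d ∸_) (+-comm u n)) ([m+n]∸[m+o]≡n∸o n d u)))

  cut-arc≤ : cut n d arc ≤ d * suc d
  cut-arc≤ = begin
    cut n d arc
      ≡⟨ cut≡∑ n d arc ⟩
    ∑[ i < n ] ∑[ j < n ] iverson ((toℕ i <ᵇ toℕ j) ∧ crosses n d arc i j)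
      ≤⟨ sum-mono (λ i → sum-mono (crossing≤rowWeight i)) ⟩
    ∑[ i < n ] ∑[ j < n ] rowWeight (toℕ i) (toℕ j)
      ≡⟨ sum-cong-≗ {n} (λ i → sum-toℕ (rowWeight (toℕ i)) n) ⟩
    ∑[ i < n ] rangeSum (rowWeight (toℕ i)) 0 n
      ≡⟨ sum-toℕ (λ u → rangeSum (rowWeight u) 0 n) n ⟩
    rangeSum (λ u → rangeSum (rowWeight u) 0 n) 0 n
      ≤⟨ rangeSum-mono 0 n (λ u _ _ → row≤rowBound u) ⟩
    rangeSum (λ u → iverson (u <ᵇ h) * rowBound d h u) 0 n
      ≡⟨ rangeSum-below (rowBound d h) h≤n ⟩
    rangeSum (rowBound d h) 0 h
      ≡⟨ rangeSum-rowBound d d≤h ⟩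
    d * suc d ∎
    where open ≤-Reasoning

-- Balanced partitions

m*2≡m+m : ∀ m → m * 2 ≡ m + m
m*2≡m+m m = trans (*-comm m 2) (cong (m +_) (+-identityʳ m))

m+m≤n+n⇒m≤n : ∀ {m n} → m + m ≤ n + n → m ≤ n
m+m≤n+n⇒m≤n m+m≤n+n = ≮⇒≥ (λ n<m → <⇒≱ (+-mono-< n<m n<m) m+m≤n+n)

half+half≤n : ∀ n → n / 2 + n / 2 ≤ n
half+half≤n n = subst (_≤ n) (m*2≡m+m (n / 2)) (m/n*n≤m n 2)

n≤1+half+half : ∀ n → n ≤ suc (n / 2 + n / 2)
n≤1+half+half n = begin
  n                       ≡⟨ m≡m%n+[m/n]*n n 2 ⟩
  n % 2 + n / 2 * 2       ≤⟨ +-monoˡ-≤ (n / 2 * 2) (≤-pred (m%n<n n 2)) ⟩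
  1 + n / 2 * 2           ≡⟨ cong suc (m*2≡m+m (n / 2)) ⟩
  suc (n / 2 + n / 2)     ∎
  where open ≤-Reasoning

balanced-half : ∀ n (A : Subset n) → ∣ A ∣ ≡ n / 2 → Balanced n A
balanced-half n A ∣A∣≡h rewrite ∣A∣≡h =
  ≤-trans (subst (_≤ n ∸ n / 2) (m+n∸n≡m (n / 2) (n / 2)) (∸-monoˡ-≤ (n / 2) (half+half≤n n))) (n≤1+n _) ,
  m≤n+o⇒m∸n≤o n (n / 2) (subst (n ≤_) (sym (+-suc (n / 2) (n / 2))) (n≤1+half+half n))

balanced⇒both-≥ : ∀ {n d} (A : Subset n) → Balanced n A → d + d < n → d ≤ ∣ A ∣ × d ≤ n ∸ ∣ A ∣
balanced⇒both-≥ {n} {d} A (a≤1+b , b≤1+a) 2d<n =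
  ≮⇒≥ (λ a<d → too-small (+-mono-≤ (<⇒≤ a<d) (≤-trans b≤1+a a<d))) ,
  ≮⇒≥ (λ b<d → too-small (+-mono-≤ (≤-trans a≤1+b b<d) (<⇒≤ b<d)))
  where
  too-small : ∣ A ∣ + (n ∸ ∣ A ∣) ≤ d + d → ⊥
  too-small small = <⇒≱ 2d<n (≤-trans (m≤n+m∸n n ∣ A ∣) small)

theorem3p2 : (n d : ℕ) → 2 ≤ d → d < n / 2 → (m : ℕ) → IsRnaNumber n d m →
    (2 * d ≤ m) × (m ≤ d * suc d)
theorem3p2 zero      d 2≤d () m _
theorem3p2 (suc n-1) d 2≤d d<h m ((A , A-balanced , cutA≡m) , minimal) = lower , upper
  where
  n = suc n-1
  2d<n : d + d < n
  2d<n = ≤-trans (+-mono-≤ d<h (<⇒≤ d<h)) (half+half≤n n)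
  open UpperBound n-1 d (n / 2) (<⇒≤ d<h) (≤-trans (m≤m+n _ _) (half+half≤n n))
  upper : m ≤ d * suc d
  upper = ≤-trans (minimal arc (balanced-half n arc ∣arc∣≡h)) cut-arc≤
  classes = balanced⇒both-≥ A A-balanced 2d<n
  four-d≤two-m : (d + d) + (d + d) ≤ m + m
  four-d≤two-m = subst (λ c → (d + d) + (d + d) ≤ c + c) cutA≡m
    (LowerBound.cut-lower-bound n-1 d A 2d<n (≤-trans (s≤s z≤n) 2≤d) (proj₁ classes) (proj₂ classes))
  lower : 2 * d ≤ m
  lower = subst (_≤ m) (cong (d +_) (sym (+-identityʳ d))) (m+m≤n+n⇒m≤n four-d≤two-m)
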